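{- Let $\gamma$ be a proper $n$-edge coloring of a signed simple graph $\Sigma$, let $a,b\in M_n$ be nonzero with $a$ absent and $b$ present at a vertex $v_0$, and let $K_{a,b}(v_0,v_m)=(v_0,\ldots,v_m)$ be the $a/b$-chain at $v_0$. Performing the $a/b$-swap at $v_0$ does not change the set of present (or absent) colors at any vertex other than $v_0$ and $v_m$. It changes the present colors at $v_0$ and $v_m$: at $v_0$ it interchanges $a$ with $b$, and at $v_m$ it interchanges $(-1)^{t_m}a$ with $(-1)^{t_m}b$.
   Context: A signed graph is $\Sigma=(\Gamma,\sigma)$ with $\Gamma$ a finite simple graph and $\sigma:E(\Gamma)\to\{+,-\}$. An incidence is a pair $(v,e)$ with $v$ an endpoint of $e$. For $n\ge1$, $M_n=\{0,\pm1,\ldots,\pm k\}$ if $n=2k+1$ and $M_n=\{\pm1,\ldots,\pm k\}$ if $n=2k$. An $n$-edge coloring is a map $\gamma$ from incidences to $M_n$ with $\gamma(v,e)=-\sigma(e)\gamma(w,e)$ for each edge $e$ with endpoints $v,w$ (so both incidences of an edge have the same magnitude, called the magnitude of the edge); it is proper if $\gamma(v,e)\neq\gamma(v,f)$ for distinct edges $e,f$ at a common vertex $v$. A color $c$ is present at $v$ if $\gamma(v,e)=c$ for some edge $e$ at $v$, absent otherwise. A trail $(v_0,\ldots,v_m)$ is a sequence of vertices with consecutive ones adjacent and no edge repeated (vertices may repeat). For a trail, $t_i$ denotes the number of positive edges among $v_0v_1,\ldots,v_{i-1}v_i$. If $a$ is absent and $b$ present at $v_0$, the $a/b$-chain at $v_0$,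 written $K_{a,b}(v_0,v_m)$, is the maximal trail $(v_0,\ldots,v_m)$ starting at $v_0$ such that (1) the edge magnitudes alternate between $|b|$ and $|a|$ along it, starting with $|b|$, and (2) $\{\gamma(v_i,v_{i-1}v_i),\gamma(v_i,v_iv_{i+1})\}=\{(-1)^{t_i}a,(-1)^{t_i}b\}$ for all $0<i<m$. For $a,b\neq0$, the $a/b$-swap at $v_0$ replaces, on every incidence of an edge of $K_{a,b}(v_0,v_m)$, the color $a$ by $b$, $b$ by $a$, $-a$ by $-b$, and $-b$ by $-a$. -}

module Defs where

open import Data.Nat using (ℕ; zero; suc; _≤_; _<_)
open import Data.Nat.Base using (_*_; _+_)
open import Data.Integer using (ℤ; +_; -_; ∣_∣; _^_; 0ℤ; 1ℤ; -1ℤ) renaming (_*_ to _*ℤ_)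
open import Data.Fin using (Fin)
open import Data.Bool using (Bool; true; false; T)
open import Data.Product using (Σ; ∃; _×_; _,_)
open import Data.Sum using (_⊎_)
open import Relation.Nullary using (¬_; yes; no)
open import Relation.Binary.PropositionalEquality using (_≡_; _≢_)
open import Function.Bundles using (_⇔_)
import Data.Integer.Properties as ℤP

data Sign : Set where
  pos neg : Sign

signℤ : Sign → ℤ
signℤ pos = 1ℤ
signℤ neg = -1ℤ

-- An edge is an unordered pair {v,w}, represented by the symmetric,
-- irreflexive adjacency relation; the sign is a symmetric function
-- (only its values on edges matter).

record SignedGraph (N : ℕ) : Set where
  field
    adj     : Fin N → Fin N → Bool
    σ       : Fin N → Fin N → Sign
    irrefl  : ∀ v → adj v v ≡ false
    adjSym  : ∀ v w → adj v w ≡ adj w v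
    σSym    : ∀ v w → T (adj v w) → σ v w ≡ σ w v

  Adj : Fin N → Fin N → Set
  Adj v w = T (adj v w)

open SignedGraph public

InM : ℕ → ℤ → Set
InM n c = ∃ λ k → (n ≡ 2 * k + 1 × ∣ c ∣ ≤ k)
                ⊎ (n ≡ 2 * k × c ≢ 0ℤ × ∣ c ∣ ≤ k)

-- An incidence (v, e) with e = vw is represented by the
-- ordered pair (v , w) with v adjacent to w; a coloring is a function
-- γ : Fin N → Fin N → ℤ whose value γ v w is the color of (v, vw)
-- (values on non-adjacent pairs are irrelevant).

Coloring : ℕ → Set
Coloring N = Fin N → Fin N → ℤ

IsEdgeColoring : ∀ {N} → SignedGraph N → ℕ → Coloring N → Set
IsEdgeColoring {N} G n γ =
  ∀ (v w : Fin N) → Adj G v w →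
    InM n (γ v w) × (γ v w ≡ - (signℤ (σ G v w) *ℤ γ w v))

IsProper : ∀ {N} → SignedGraph N → Coloring N → Set
IsProper {N} G γ =
  ∀ (v w w′ : Fin N) → Adj G v w → Adj G v w′ → w ≢ w′ → γ v w ≢ γ v w′

Present : ∀ {N} → SignedGraph N → Coloring N → Fin N → ℤ → Set
Present {N} G γ v c = ∃ λ (w : Fin N) → Adj G v w × γ v w ≡ c

Absent : ∀ {N} → SignedGraph N → Coloring N → Fin N → ℤ → Set
Absent G γ v c = ¬ Present G γ v c

-- Trails.  A trail (v_0, …, v_m) is represented by its length m and a
-- function p : ℕ → Fin N with v_i = p i (values p i for i > m are
-- irrelevant).

SameEdge : ∀ {N} → Fin N → Fin N → Fin N → Fin N → Set
SameEdge x y u v = (x ≡ u × y ≡ v) ⊎ (x ≡ v × y ≡ u)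

IsTrail : ∀ {N} → SignedGraph N → ℕ → (ℕ → Fin N) → Set
IsTrail G m p =
  (∀ i → i < m → Adj G (p i) (p (suc i))) ×
  (∀ i j → i < j → j < m → ¬ SameEdge (p i) (p (suc i)) (p j) (p (suc j)))

isPos : Sign → ℕ
isPos pos = 1
isPos neg = 0

tcount : ∀ {N} → SignedGraph N → (ℕ → Fin N) → ℕ → ℕ
tcount G p zero    = 0
tcount G p (suc i) = tcount G p i + isPos (σ G (p i) (p (suc i)))

negPow : ℕ → ℤ
negPow t = -1ℤ ^ t

SameSet2 : ℤ → ℤ → ℤ → ℤ → Set
SameSet2 x y u v = ∀ z → ((z ≡ x ⊎ z ≡ y) ⇔ (z ≡ u ⊎ z ≡ v))

altMag : ℤ → ℤ → ℕ → ℕ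
altMag a b zero          = ∣ b ∣
altMag a b (suc zero)    = ∣ a ∣
altMag a b (suc (suc i)) = altMag a b i

IsChainTrail : ∀ {N} → SignedGraph N → Coloring N → ℤ → ℤ → Fin N →
               ℕ → (ℕ → Fin N) → Set
IsChainTrail G γ a b v₀ m p =
  p 0 ≡ v₀ ×
  IsTrail G m p ×
  (1 ≤ m → γ (p 0) (p 1) ≡ b) ×
  (∀ i → i < m → ∣ γ (p i) (p (suc i)) ∣ ≡ altMag a b i) ×
  (∀ j → suc j < m →
     SameSet2 (γ (p (suc j)) (p j)) (γ (p (suc j)) (p (suc (suc j))))
              (negPow (tcount G p (suc j)) *ℤ a)
              (negPow (tcount G p (suc j)) *ℤ b))

IsChain : ∀ {N} → SignedGraph N → Coloring N → ℤ → ℤ → Fin N →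
          ℕ → (ℕ → Fin N) → Set
IsChain {N} G γ a b v₀ m p =
  IsChainTrail G γ a b v₀ m p ×
  (∀ m′ (q : ℕ → Fin N) → m ≤ m′ → (∀ i → i ≤ m → q i ≡ p i) →
     IsChainTrail G γ a b v₀ m′ q → m′ ≡ m)

EdgeOf : ∀ {N} → ℕ → (ℕ → Fin N) → Fin N → Fin N → Set
EdgeOf m p v w = ∃ λ i → i < m × SameEdge v w (p i) (p (suc i))

swapColor : ℤ → ℤ → ℤ → ℤ
swapColor a b c with c ℤP.≟ a
... | yes _ = b
... | no _ with c ℤP.≟ b
...   | yes _ = a
...   | no _ with c ℤP.≟ - a
...     | yes _ = - b
...     | no _ with c ℤP.≟ - b
...       | yes _ = - a
...       | no _  = c

IsSwap : ∀ {N} → ℤ → ℤ → ℕ → (ℕ → Fin N) → Coloring N → Coloring N → Set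
IsSwap {N} a b m p γ γ′ =
  ∀ (v w : Fin N) →
    (EdgeOf m p v w → γ′ v w ≡ swapColor a b (γ v w)) ×
    (¬ EdgeOf m p v w → γ′ v w ≡ γ v w)

transp : ℤ → ℤ → ℤ → ℤ
transp x y c with c ℤP.≟ x
... | yes _ = y
... | no _ with c ℤP.≟ y
...   | yes _ = x
...   | no _  = c

-- At an inner vertex v_i of the chain the two chain edges carry the
-- colours (-1)^{t_i} a and (-1)^{t_i} b, and the swap merely exchanges them between the two edges, so the set
-- of colours there does not change; off the chain nothing changes at all. Hence only the first incidence
-- (where b becomes a) and the last one (where x ∈ (-1)^{t_m}{a, b} becomes the other element y) alter the
-- colour sets, and it remains to see that the new colours were absent. For a at v₀ this is the hypothesis.
-- For y at v_m: an edge at v_m off the chain with colour y would extend the chain, contradicting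
-- maximality; and the two chain edges at an inner visit of v_m carry a pair (-1)^t {a, b}, which cannot
-- contain y, since two such pairs that meet coincide and so x would be repeated at v_m.

module Submission where

open import Defs
open import Data.Nat using (ℕ; zero; suc; _+_; _≤_; _<_; z≤n; s≤s; _≤?_; anyUpTo?)
import Data.Nat.Properties as ℕP
open import Data.Integer using (ℤ; 0ℤ; 1ℤ; -1ℤ; -_; +_; -[1+_]; ∣_∣) renaming (_*_ to _*ℤ_)
import Data.Integer.Properties as ℤP
open import Data.Bool using (T)
open import Data.Fin using (Fin)
import Data.Fin.Properties as FinP
open import Data.Product using (_×_; _,_; ∃; proj₁; proj₂)
open import Data.Sum using (_⊎_; inj₁; inj₂; [_,_])
open import Data.Empty using (⊥; ⊥-elim)
open import Function.Base using (id; _∘_)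
open import Function.Bundles using (_⇔_; mk⇔; module Equivalence)
open import Function.Definitions using (Injective)
open import Function.Related.TypeIsomorphisms using (¬-cong-⇔)
open import Relation.Nullary using (¬_; Dec; yes; no)
open import Relation.Nullary.Decidable using (_×-dec_; _⊎-dec_; decidable-stable)
open import Relation.Binary.Definitions using (tri<; tri≈; tri>)
open import Relation.Binary.PropositionalEquality hiding ([_])

opposite : Sign → Sign
opposite pos = neg
opposite neg = pos

infixr 7 _·_
_·_ : Sign → ℤ → ℤ
pos · z = z
neg · z = - z

parity : ℕ → Sign
parity zero    = pos
parity (suc t) = opposite (parity t)

neg-· : ∀ ε z → - (ε · z) ≡ opposite ε · z
neg-· pos z = refl
neg-· neg z = ℤP.neg-involutive z

∣·∣ : ∀ ε z → ∣ ε · z ∣ ≡ ∣ z ∣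
∣·∣ pos z = refl
∣·∣ neg z = ℤP.∣-i∣≡∣i∣ z

negPow-* : ∀ t z → negPow t *ℤ z ≡ parity t · z
negPow-* zero    z = ℤP.*-identityˡ z
negPow-* (suc t) z = begin
  (-1ℤ *ℤ negPow t) *ℤ z  ≡⟨ ℤP.*-assoc -1ℤ (negPow t) z ⟩
  -1ℤ *ℤ (negPow t *ℤ z)  ≡⟨ ℤP.-1*i≡-i _ ⟩
  - (negPow t *ℤ z)       ≡⟨ cong -_ (negPow-* t z) ⟩
  - (parity t · z)        ≡⟨ neg-· (parity t) z ⟩
  parity (suc t) · z      ∎
  where open ≡-Reasoning

-- A positive edge flips the sign of a colour between its two ends, a negative one keeps it.
crossing : ∀ σ t z → - (signℤ σ *ℤ (parity t · z)) ≡ parity (t + isPos σ) · z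
crossing pos t z = begin
  - (1ℤ *ℤ (parity t · z))  ≡⟨ cong -_ (ℤP.*-identityˡ _) ⟩
  - (parity t · z)          ≡⟨ neg-· (parity t) z ⟩
  parity (suc t) · z        ≡⟨ cong (λ s → parity s · z) (ℕP.+-comm 1 t) ⟩
  parity (t + 1) · z        ∎
  where open ≡-Reasoning
crossing neg t z = begin
  - (-1ℤ *ℤ (parity t · z))  ≡⟨ cong -_ (ℤP.-1*i≡-i _) ⟩
  - - (parity t · z)         ≡⟨ ℤP.neg-involutive _ ⟩
  parity t · z               ≡⟨ cong (λ s → parity s · z) (sym (ℕP.+-identityʳ t)) ⟩
  parity (t + 0) · z         ∎
  where open ≡-Reasoning

self-negating⇒0 : ∀ {z} → z ≡ - z → z ≡ 0ℤ
self-negating⇒0 {+ zero}  _ = refl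
self-negating⇒0 {+ suc _} ()
self-negating⇒0 { -[1+ _ ]} ()

OneOf : ℤ → ℤ → ℤ → Set
OneOf u v z = z ≡ u ⊎ z ≡ v

SamePair : ℤ → ℤ → ℤ → ℤ → Set
SamePair u v x y = (u ≡ x × v ≡ y) ⊎ (u ≡ y × v ≡ x)

samePair-oneOf : ∀ {u v x y z} → SamePair u v x y → OneOf u v z → OneOf x y z
samePair-oneOf (inj₁ (refl , refl)) z∈ = z∈
samePair-oneOf (inj₂ (refl , refl)) (inj₁ z≡u) = inj₂ z≡u
samePair-oneOf (inj₂ (refl , refl)) (inj₂ z≡v) = inj₁ z≡v

samePair-oneOf⁻ : ∀ {u v x y z} → SamePair u v x y → OneOf x y z → OneOf u v z
samePair-oneOf⁻ (inj₁ (refl , refl)) z∈ = z∈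
samePair-oneOf⁻ (inj₂ (refl , refl)) (inj₁ z≡x) = inj₂ z≡x
samePair-oneOf⁻ (inj₂ (refl , refl)) (inj₂ z≡y) = inj₁ z≡y

samePair⇒sameSet2 : ∀ {u v x y} → SamePair u v x y → SameSet2 u v x y
samePair⇒sameSet2 same z = mk⇔ (samePair-oneOf same) (samePair-oneOf⁻ same)

sameSet2⇒samePair : ∀ {u v x y} → x ≢ y → SameSet2 u v x y → SamePair u v x y
sameSet2⇒samePair {u} {v} {x} {y} x≢y same
  with Equivalence.to (same u) (inj₁ refl) | Equivalence.to (same v) (inj₂ refl)
... | inj₁ u≡x | inj₂ v≡y = inj₁ (u≡x , v≡y)
... | inj₂ u≡y | inj₁ v≡x = inj₂ (u≡y , v≡x)
... | inj₁ refl | inj₁ refl = ⊥-elim ([ x≢y ∘ sym , x≢y ∘ sym ] (Equivalence.from (same y) (inj₂ refl)))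
... | inj₂ refl | inj₂ refl = ⊥-elim ([ x≢y , x≢y ] (Equivalence.from (same x) (inj₁ refl)))

transp-left : ∀ x y → transp x y x ≡ y
transp-left x y with x ℤP.≟ x
... | yes _   = refl
... | no x≢x = ⊥-elim (x≢x refl)

transp-right : ∀ x y → transp x y y ≡ x
transp-right x y with y ℤP.≟ x
... | yes y≡x = y≡x
... | no _ with y ℤP.≟ y
...   | yes _  = refl
...   | no y≢y = ⊥-elim (y≢y refl)

transp-fixes : ∀ x y {c} → ¬ OneOf x y c → transp x y c ≡ c
transp-fixes x y {c} c∉ with c ℤP.≟ x
... | yes c≡x = ⊥-elim (c∉ (inj₁ c≡x))
... | no _ with c ℤP.≟ y
...   | yes c≡y = ⊥-elim (c∉ (inj₂ c≡y))
...   | no _    = refl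

transp-involutive : ∀ x y c → transp x y (transp x y c) ≡ c
transp-involutive x y c with c ℤP.≟ x
... | yes refl = transp-right c y
... | no c≢x with c ℤP.≟ y
...   | yes refl = transp-left x c
...   | no c≢y  = transp-fixes x y [ c≢x , c≢y ]

transp-injective : ∀ x y → Injective _≡_ _≡_ (transp x y)
transp-injective x y {c} {d} e = begin
  c                          ≡⟨ transp-involutive x y c ⟨
  transp x y (transp x y c)  ≡⟨ cong (transp x y) e ⟩
  transp x y (transp x y d)  ≡⟨ transp-involutive x y d ⟩
  d                          ∎
  where open ≡-Reasoning

transp-samePair : ∀ {x y u v} → SamePair u v x y → transp x y v ≡ u
transp-samePair {x} {y} (inj₁ (refl , refl)) = transp-right x y
transp-samePair {x} {y} (inj₂ (refl , refl)) = transp-left x y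

altMag-step : ∀ {a b u u′} i → SamePair u u′ a b → ∣ u ∣ ≡ altMag a b i → ∣ u′ ∣ ≡ altMag a b (suc i)
altMag-step zero          (inj₁ (refl , refl)) ∣a∣≡∣b∣ = sym ∣a∣≡∣b∣
altMag-step zero          (inj₂ (refl , refl)) _       = refl
altMag-step (suc zero)    (inj₁ (refl , refl)) _       = refl
altMag-step (suc zero)    (inj₂ (refl , refl)) ∣b∣≡∣a∣ = sym ∣b∣≡∣a∣
altMag-step (suc (suc i)) same                 ∣u∣≡    = altMag-step i same ∣u∣≡

module SignedColours {a b : ℤ} (a≢0 : a ≢ 0ℤ) (b≢0 : b ≢ 0ℤ) (a≢b : a ≢ b) where

  neg-move : ∀ {x y} → - x ≡ y → x ≡ - y
  neg-move {x} -x≡y = trans (sym (ℤP.neg-involutive x)) (cong -_ -x≡y)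

  ·-≢ : ∀ ε → ε · a ≢ ε · b
  ·-≢ pos = a≢b
  ·-≢ neg = a≢b ∘ ℤP.neg-injective

  swapColor-·a : ∀ ε → swapColor a b (ε · a) ≡ ε · b
  swapColor-·a pos with a ℤP.≟ a
  ... | yes _   = refl
  ... | no a≢a = ⊥-elim (a≢a refl)
  swapColor-·a neg with - a ℤP.≟ a
  ... | yes -a≡a = ⊥-elim (a≢0 (self-negating⇒0 (sym -a≡a)))
  ... | no _ with - a ℤP.≟ b
  ...   | yes -a≡b = neg-move -a≡b
  ...   | no _ with - a ℤP.≟ - a
  ...     | yes _     = refl
  ...     | no -a≢-a = ⊥-elim (-a≢-a refl)

  swapColor-·b : ∀ ε → swapColor a b (ε · b) ≡ ε · a
  swapColor-·b pos with b ℤP.≟ a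
  ... | yes b≡a = ⊥-elim (a≢b (sym b≡a))
  ... | no _ with b ℤP.≟ b
  ...   | yes _   = refl
  ...   | no b≢b = ⊥-elim (b≢b refl)
  swapColor-·b neg with - b ℤP.≟ a
  ... | yes -b≡a = neg-move -b≡a
  ... | no _ with - b ℤP.≟ b
  ...   | yes -b≡b = ⊥-elim (b≢0 (self-negating⇒0 (sym -b≡b)))
  ...   | no _ with - b ℤP.≟ - a
  ...     | yes -b≡-a = -b≡-a
  ...     | no _ with - b ℤP.≟ - b
  ...       | yes _     = refl
  ...       | no -b≢-b = ⊥-elim (-b≢-b refl)

  swapColor-samePair : ∀ ε {u v} → SamePair u v (ε · a) (ε · b) →
                       swapColor a b u ≡ v × swapColor a b v ≡ u
  swapColor-samePair ε (inj₁ (refl , refl)) = swapColor-·a ε , swapColor-·b ε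
  swapColor-samePair ε (inj₂ (refl , refl)) = swapColor-·b ε , swapColor-·a ε

  swapColor-carried : ∀ ε {u u′} → SamePair u u′ a b → swapColor a b (ε · u) ≡ ε · u′
  swapColor-carried ε (inj₁ (refl , refl)) = swapColor-·a ε
  swapColor-carried ε (inj₂ (refl , refl)) = swapColor-·b ε

  ·-samePair : ∀ ε {u u′} → SamePair u u′ a b → SamePair (ε · u) (ε · u′) (ε · a) (ε · b)
  ·-samePair ε (inj₁ (refl , refl)) = inj₁ (refl , refl)
  ·-samePair ε (inj₂ (refl , refl)) = inj₂ (refl , refl)

  opposite-pairs-meet : ∀ {z} → OneOf a b z → OneOf (- a) (- b) z → b ≡ - a
  opposite-pairs-meet (inj₁ refl) (inj₁ a≡-a) = ⊥-elim (a≢0 (self-negating⇒0 a≡-a))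
  opposite-pairs-meet (inj₁ refl) (inj₂ a≡-b) = neg-move (sym a≡-b)
  opposite-pairs-meet (inj₂ refl) (inj₁ b≡-a) = b≡-a
  opposite-pairs-meet (inj₂ refl) (inj₂ b≡-b) = ⊥-elim (b≢0 (self-negating⇒0 b≡-b))

  -- {ε a, ε b} and {δ a, δ b} are either disjoint or equal.
  signed-overlap : ∀ ε δ {z z′} → OneOf (ε · a) (ε · b) z → OneOf (δ · a) (δ · b) z →
                   OneOf (δ · a) (δ · b) z′ → OneOf (ε · a) (ε · b) z′
  signed-overlap pos pos _ _ z′∈ = z′∈
  signed-overlap neg neg _ _ z′∈ = z′∈
  signed-overlap pos neg z∈ z∈′ (inj₁ z′≡-a) = inj₂ (trans z′≡-a (sym (opposite-pairs-meet z∈ z∈′)))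
  signed-overlap pos neg z∈ z∈′ (inj₂ z′≡-b) =
    inj₁ (trans z′≡-b (sym (neg-move (sym (opposite-pairs-meet z∈ z∈′)))))
  signed-overlap neg pos z∈ z∈′ (inj₁ z′≡a) =
    inj₂ (trans z′≡a (neg-move (sym (opposite-pairs-meet z∈′ z∈))))
  signed-overlap neg pos z∈ z∈′ (inj₂ z′≡b) = inj₁ (trans z′≡b (opposite-pairs-meet z∈′ z∈))

module _ {N} (G : SignedGraph N) where

  adj-sym : ∀ {v w} → Adj G v w → Adj G w v
  adj-sym {v} {w} = subst T (adjSym G v w)

  adj-irrefl : ∀ {v w} → Adj G v w → v ≢ w
  adj-irrefl {v} vv refl = subst T (irrefl G v) vv

  proper-injective : ∀ {γ} → IsProper G γ → ∀ {v w w′} →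
                     Adj G v w → Adj G v w′ → γ v w ≡ γ v w′ → w ≡ w′
  proper-injective proper {v} {w} {w′} vw vw′ same =
    decidable-stable (w FinP.≟ w′) (λ w≢w′ → proper v w w′ vw vw′ w≢w′ same)

  present-relabel : ∀ (γ γ′ : Coloring N) v (T : ℤ → ℤ) → Injective _≡_ _≡_ T →
    (∀ w → Adj G v w → ∃ λ w′ → Adj G v w′ × T (γ′ v w) ≡ γ v w′ × T (γ′ v w′) ≡ γ v w) →
    ∀ c → Present G γ′ v c ⇔ Present G γ v (T c)
  present-relabel γ γ′ v T T-injective matching c = mk⇔ to from
    where
    to : Present G γ′ v c → Present G γ v (T c)
    to (w , vw , refl) with matching w vw
    ... | w′ , vw′ , e , _ = w′ , vw′ , sym e
    from : Present G γ v (T c) → Present G γ′ v c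
    from (w , vw , γvw≡Tc) with matching w vw
    ... | w′ , vw′ , _ , e = w′ , vw′ , T-injective (trans e γvw≡Tc)

SameEdge-sym : ∀ {N} {x y u v : Fin N} → SameEdge x y u v → SameEdge u v x y
SameEdge-sym (inj₁ (x≡u , y≡v)) = inj₁ (sym x≡u , sym y≡v)
SameEdge-sym (inj₂ (x≡v , y≡u)) = inj₂ (sym y≡u , sym x≡v)

EdgeOf? : ∀ {N} m (p : ℕ → Fin N) v w → Dec (EdgeOf m p v w)
EdgeOf? m p v w = anyUpTo? (λ i → sameEdge? (p i) (p (suc i))) m
  where
  sameEdge? : ∀ s t → Dec (SameEdge v w s t)
  sameEdge? s t = (v FinP.≟ s ×-dec w FinP.≟ t) ⊎-dec (v FinP.≟ t ×-dec w FinP.≟ s)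

module _ {N} (G : SignedGraph N) {m} {p : ℕ → Fin N} (trail : IsTrail G m p) where

  trail-edge-injective : ∀ {i j} → i < m → j < m →
                         SameEdge (p i) (p (suc i)) (p j) (p (suc j)) → i ≡ j
  trail-edge-injective {i} {j} i<m j<m same with ℕP.<-cmp i j
  ... | tri< i<j _ _ = ⊥-elim (proj₂ trail i j i<j j<m same)
  ... | tri≈ _ i≡j _ = i≡j
  ... | tri> _ _ j<i = ⊥-elim (proj₂ trail j i j<i i<m (SameEdge-sym same))

  trail-no-reversal : ∀ {i j} → i < m → j < m → p i ≡ p (suc j) → p (suc i) ≡ p j → ⊥
  trail-no-reversal i<m j<m e e′ with trail-edge-injective i<m j<m (inj₂ (e , e′))
  ... | refl = adj-irrefl G (proj₁ trail _ i<m) e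

module Chain {N} (G : SignedGraph N) (γ γ′ : Coloring N) (a b : ℤ) (k : ℕ) (p : ℕ → Fin N)
  (skew : ∀ v w → Adj G v w → γ v w ≡ - (signℤ (σ G v w) *ℤ γ w v))
  (proper : IsProper G γ) (a≢0 : a ≢ 0ℤ) (b≢0 : b ≢ 0ℤ)
  (absent : Absent G γ (p 0) a) (present : Present G γ (p 0) b)
  (trail : IsTrail G (suc k) p)
  (starts-with-b : 1 ≤ suc k → γ (p 0) (p 1) ≡ b)
  (magnitude : ∀ i → i < suc k → ∣ γ (p i) (p (suc i)) ∣ ≡ altMag a b i)
  (condition : ∀ j → suc j < suc k →
     SameSet2 (γ (p (suc j)) (p j)) (γ (p (suc j)) (p (suc (suc j))))
              (negPow (tcount G p (suc j)) *ℤ a) (negPow (tcount G p (suc j)) *ℤ b))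
  (maximal : ∀ m′ (q : ℕ → Fin N) → suc k ≤ m′ → (∀ i → i ≤ suc k → q i ≡ p i) →
     IsChainTrail G γ a b (p 0) m′ q → m′ ≡ suc k)
  (swap : IsSwap a b (suc k) p γ γ′) where

  m : ℕ
  m = suc k

  a≢b : a ≢ b
  a≢b refl = absent present

  open SignedColours a≢0 b≢0 a≢b

  adjacent : ∀ i → i < m → Adj G (p i) (p (suc i))
  adjacent = proj₁ trail

  end-adj : Adj G (p m) (p k)
  end-adj = adj-sym G (adjacent k (ℕP.n<1+n k))

  first-colour : γ (p 0) (p 1) ≡ b
  first-colour = starts-with-b (s≤s z≤n)

  ε : ℕ → Sign
  ε i = parity (tcount G p i)

  inner-pair : ∀ j → suc j < m →
    SamePair (γ (p (suc j)) (p j)) (γ (p (suc j)) (p (suc (suc j)))) (ε (suc j) · a) (ε (suc j) · b)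
  inner-pair j lt = sameSet2⇒samePair (·-≢ (ε (suc j)))
    (subst₂ (SameSet2 _ _) (negPow-* (tcount G p (suc j)) a) (negPow-* (tcount G p (suc j)) b) (condition j lt))

  backward-colour : ∀ i → i < m → ∀ {z} →
    γ (p i) (p (suc i)) ≡ ε i · z → γ (p (suc i)) (p i) ≡ ε (suc i) · z
  backward-colour i i<m {z} forward = begin
    γ (p (suc i)) (p i)                                       ≡⟨ skew _ _ (adj-sym G (adjacent i i<m)) ⟩
    - (signℤ (σ G (p (suc i)) (p i)) *ℤ γ (p i) (p (suc i)))  ≡⟨ cong₂ (λ s c → - (signℤ s *ℤ c))
                                                                   (sym (σSym G _ _ (adjacent i i<m))) forward ⟩
    - (signℤ (σ G (p i) (p (suc i))) *ℤ (ε i · z))            ≡⟨ crossing _ (tcount G p i) z ⟩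
    ε (suc i) · z                                             ∎
    where open ≡-Reasoning

  record Carried (i : ℕ) : Set where
    field
      u u′    : ℤ
      carried : SamePair u u′ a b
      colour  : γ (p i) (p (suc i)) ≡ ε i · u

  forward-colour : ∀ i → i < m → Carried i
  forward-colour zero    _  = record { carried = inj₂ (refl , refl) ; colour = first-colour }
  forward-colour (suc j) lt with inner-pair j lt
  ... | inj₁ (_ , fwd≡b) = record { carried = inj₂ (refl , refl) ; colour = fwd≡b }
  ... | inj₂ (_ , fwd≡a) = record { carried = inj₁ (refl , refl) ; colour = fwd≡a }

  open Carried (forward-colour k (ℕP.n<1+n k))

  x y : ℤ
  x = γ (p m) (p k)
  y = swapColor a b x

  x≡ε·u : x ≡ ε m · u
  x≡ε·u = backward-colour k (ℕP.n<1+n k) colour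

  y≡ε·u′ : y ≡ ε m · u′
  y≡ε·u′ = trans (cong (swapColor a b) x≡ε·u) (swapColor-carried (ε m) carried)

  last-pair-signed : SamePair x y (ε m · a) (ε m · b)
  last-pair-signed = subst₂ (λ c d → SamePair c d (ε m · a) (ε m · b))
    (sym x≡ε·u) (sym y≡ε·u′) (·-samePair (ε m) carried)

  sa sb : ℤ
  sa = negPow (tcount G p m) *ℤ a
  sb = negPow (tcount G p m) *ℤ b

  last-pair : SamePair x y sa sb
  last-pair = subst₂ (SamePair x y) (sym (negPow-* (tcount G p m) a)) (sym (negPow-* (tcount G p m) b))
    last-pair-signed

  y-magnitude : ∣ y ∣ ≡ altMag a b m
  y-magnitude = begin
    ∣ y ∣          ≡⟨ cong ∣_∣ y≡ε·u′ ⟩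
    ∣ ε m · u′ ∣   ≡⟨ ∣·∣ (ε m) u′ ⟩
    ∣ u′ ∣         ≡⟨ altMag-step k carried ∣u∣≡ ⟩
    altMag a b m  ∎
    where
    open ≡-Reasoning
    ∣u∣≡ : ∣ u ∣ ≡ altMag a b k
    ∣u∣≡ = trans (sym (∣·∣ (ε k) u)) (trans (cong ∣_∣ (sym colour)) (magnitude k (ℕP.n<1+n k)))

  swap-off : ∀ {v w} → ¬ EdgeOf m p v w → γ′ v w ≡ γ v w
  swap-off {v} {w} = proj₂ (swap v w)

  swap-on : ∀ {v w} → EdgeOf m p v w → γ′ v w ≡ swapColor a b (γ v w)
  swap-on {v} {w} = proj₁ (swap v w)

  swap-first : γ′ (p 0) (p 1) ≡ a
  swap-first = trans (swap-on (0 , s≤s z≤n , inj₁ (refl , refl)))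
                     (trans (cong (swapColor a b) first-colour) (swapColor-·b pos))

  swap-last : γ′ (p m) (p k) ≡ y
  swap-last = swap-on (k , ℕP.n<1+n k , inj₂ (refl , refl))

  swap-inner : ∀ j → suc j < m →
    γ′ (p (suc j)) (p j) ≡ γ (p (suc j)) (p (suc (suc j))) ×
    γ′ (p (suc j)) (p (suc (suc j))) ≡ γ (p (suc j)) (p j)
  swap-inner j lt with swapColor-samePair (ε (suc j)) (inner-pair j lt)
  ... | back↦fwd , fwd↦back =
    trans (swap-on (j , ℕP.<⇒≤ lt , inj₂ (refl , refl))) back↦fwd ,
    trans (swap-on (suc j , lt , inj₁ (refl , refl))) fwd↦back

  FirstIncidence LastIncidence : Fin N → Fin N → Set
  FirstIncidence v w = v ≡ p 0 × w ≡ p 1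
  LastIncidence  v w = v ≡ p m × w ≡ p k

  inner-back-not-first : ∀ j → suc j < m → ¬ FirstIncidence (p (suc j)) (p j)
  inner-back-not-first j lt (e₁ , e₂) = trail-no-reversal G trail (s≤s z≤n) (ℕP.<⇒≤ lt) (sym e₁) (sym e₂)

  inner-fwd-not-first : ∀ j → suc j < m → ¬ FirstIncidence (p (suc j)) (p (suc (suc j)))
  inner-fwd-not-first j lt (e₁ , e₂) with trail-edge-injective G trail lt (s≤s z≤n) (inj₁ (e₁ , e₂))
  ... | ()

  inner-back-not-last : ∀ j → suc j < m → ¬ LastIncidence (p (suc j)) (p j)
  inner-back-not-last j lt (e₁ , e₂) =
    ℕP.<-irrefl (trail-edge-injective G trail (ℕP.<⇒≤ lt) (ℕP.n<1+n k) (inj₁ (e₂ , e₁))) (ℕP.≤-pred lt)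

  inner-fwd-not-last : ∀ j → suc j < m → ¬ LastIncidence (p (suc j)) (p (suc (suc j)))
  inner-fwd-not-last j lt (e₁ , e₂) = trail-no-reversal G trail lt (ℕP.n<1+n k) e₁ e₂

  last-not-first : ¬ FirstIncidence (p m) (p k)
  last-not-first (e₁ , e₂) = trail-no-reversal G trail (s≤s z≤n) (ℕP.n<1+n k) (sym e₁) (sym e₂)

  data Incidence : Fin N → Fin N → Set where
    off-chain  : ∀ {v w} → ¬ EdgeOf m p v w → Incidence v w
    first      : Incidence (p 0) (p 1)
    last       : Incidence (p m) (p k)
    inner-back : ∀ j → suc j < m → Incidence (p (suc j)) (p j)
    inner-fwd  : ∀ j → suc j < m → Incidence (p (suc j)) (p (suc (suc j)))

  classify : ∀ v w → Incidence v w
  classify v w with EdgeOf? m p v w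
  ... | no ∉ = off-chain ∉
  ... | yes (zero  , _  , inj₁ (refl , refl)) = first
  ... | yes (suc j , lt , inj₁ (refl , refl)) = inner-fwd j lt
  ... | yes (i     , lt , inj₂ (refl , refl)) with ℕP.m<1+n⇒m<n∨m≡n lt
  ...   | inj₁ i<k  = inner-back i (s≤s i<k)
  ...   | inj₂ refl = last

  FixesOffEnds : Fin N → (ℤ → ℤ) → Set
  FixesOffEnds v T = ∀ w → Adj G v w → ¬ FirstIncidence v w → ¬ LastIncidence v w → T (γ v w) ≡ γ v w

  inner-back-fixed : ∀ T j (lt : suc j < m) → FixesOffEnds (p (suc j)) T →
                     T (γ (p (suc j)) (p j)) ≡ γ (p (suc j)) (p j)
  inner-back-fixed T j lt fixes = fixes (p j) (adj-sym G (adjacent j (ℕP.<⇒≤ lt)))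
    (inner-back-not-first j lt) (inner-back-not-last j lt)

  inner-fwd-fixed : ∀ T j (lt : suc j < m) → FixesOffEnds (p (suc j)) T →
                    T (γ (p (suc j)) (p (suc (suc j)))) ≡ γ (p (suc j)) (p (suc (suc j)))
  inner-fwd-fixed T j lt fixes = fixes (p (suc (suc j))) (adjacent (suc j) lt)
    (inner-fwd-not-first j lt) (inner-fwd-not-last j lt)

  swap-matches : ∀ v (T : ℤ → ℤ) → FixesOffEnds v T → (v ≡ p 0 → T a ≡ b) → (v ≡ p m → T y ≡ x) →
    ∀ w → Adj G v w → ∃ λ w′ → Adj G v w′ × T (γ′ v w) ≡ γ v w′ × T (γ′ v w′) ≡ γ v w
  swap-matches v T fixes at-first at-last w vw with classify v w
  ... | off-chain ∉ = w , vw , unchanged , unchanged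
    where
    unchanged : T (γ′ v w) ≡ γ v w
    unchanged = trans (cong T (swap-off ∉)) (fixes w vw
      (λ (e₁ , e₂) → ∉ (0 , s≤s z≤n , inj₁ (e₁ , e₂)))
      (λ (e₁ , e₂) → ∉ (k , ℕP.n<1+n k , inj₂ (e₁ , e₂))))
  ... | first = w , vw , swapped , swapped
    where
    swapped : T (γ′ (p 0) (p 1)) ≡ γ (p 0) (p 1)
    swapped = trans (cong T swap-first) (trans (at-first refl) (sym first-colour))
  ... | last = w , vw , swapped , swapped
    where
    swapped : T (γ′ (p m) (p k)) ≡ γ (p m) (p k)
    swapped = trans (cong T swap-last) (at-last refl)
  ... | inner-back j lt = p (suc (suc j)) , adjacent (suc j) lt ,
    trans (cong T (proj₁ (swap-inner j lt))) (inner-fwd-fixed T j lt fixes) ,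
    trans (cong T (proj₂ (swap-inner j lt))) (inner-back-fixed T j lt fixes)
  ... | inner-fwd j lt = p j , adj-sym G (adjacent j (ℕP.<⇒≤ lt)) ,
    trans (cong T (proj₂ (swap-inner j lt))) (inner-back-fixed T j lt fixes) ,
    trans (cong T (proj₁ (swap-inner j lt))) (inner-fwd-fixed T j lt fixes)

  swap-present : ∀ v (T : ℤ → ℤ) → Injective _≡_ _≡_ T → FixesOffEnds v T →
    (v ≡ p 0 → T a ≡ b) → (v ≡ p m → T y ≡ x) → ∀ c → Present G γ′ v c ⇔ Present G γ v (T c)
  swap-present v T T-injective fixes at-first at-last =
    present-relabel G γ γ′ v T T-injective (swap-matches v T fixes at-first at-last)

  start-colours-avoid : ∀ {v w} → v ≡ p 0 → Adj G v w → ¬ FirstIncidence v w → ¬ OneOf a b (γ v w)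
  start-colours-avoid refl vw _      (inj₁ c≡a) = absent (_ , vw , c≡a)
  start-colours-avoid refl vw ¬first (inj₂ c≡b) =
    ¬first (refl , proper-injective G proper vw (adjacent 0 (s≤s z≤n)) (trans c≡b (sym first-colour)))

  end-colour-unique : ∀ {v w} → v ≡ p m → Adj G v w → γ v w ≡ x → w ≡ p k
  end-colour-unique refl vw c≡x = proper-injective G proper vw end-adj c≡x

  extend : Fin N → ℕ → Fin N
  extend w i with i ≤? m
  ... | yes _ = p i
  ... | no _  = w

  extend-old : ∀ w {i} → i ≤ m → extend w i ≡ p i
  extend-old w {i} i≤m with i ≤? m
  ... | yes _   = refl
  ... | no i≰m = ⊥-elim (i≰m i≤m)

  extend-new : ∀ w → extend w (suc m) ≡ w
  extend-new w with suc m ≤? m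
  ... | yes m<m = ⊥-elim (ℕP.<-irrefl refl m<m)
  ... | no _    = refl

  tcount-extend : ∀ w {i} → i ≤ m → tcount G (extend w) i ≡ tcount G p i
  tcount-extend w {zero}  _  = refl
  tcount-extend w {suc i} lt = cong₂ _+_ (tcount-extend w (ℕP.<⇒≤ lt))
    (cong isPos (cong₂ (σ G) (extend-old w (ℕP.<⇒≤ lt)) (extend-old w lt)))

  extension-is-chain : ∀ w → Adj G (p m) w → ¬ EdgeOf m p (p m) w → γ (p m) w ≡ y →
                       IsChainTrail G γ a b (p 0) (suc m) (extend w)
  extension-is-chain w end-w new w-colour =
    extend-old w z≤n , (adjacent′ , distinct′) , (λ _ → first′) , magnitude′ , condition′
    where
    q : ℕ → Fin N
    q = extend w

    adjacent′ : ∀ i → i < suc m → Adj G (q i) (q (suc i))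
    adjacent′ i lt with ℕP.m<1+n⇒m<n∨m≡n lt
    ... | inj₁ i<m rewrite extend-old w (ℕP.<⇒≤ i<m) | extend-old w i<m = adjacent i i<m
    ... | inj₂ refl rewrite extend-old w (ℕP.≤-refl {m}) | extend-new w = end-w

    distinct′ : ∀ i j → i < j → j < suc m → ¬ SameEdge (q i) (q (suc i)) (q j) (q (suc j))
    distinct′ i j i<j lt with ℕP.m<1+n⇒m<n∨m≡n lt
    ... | inj₁ j<m rewrite extend-old w (ℕP.<⇒≤ (ℕP.<-trans i<j j<m)) | extend-old w (ℕP.<-trans i<j j<m)
                         | extend-old w (ℕP.<⇒≤ j<m) | extend-old w j<m = proj₂ trail i j i<j j<m
    ... | inj₂ refl rewrite extend-old w (ℕP.<⇒≤ i<j) | extend-old w i<j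
                          | extend-old w (ℕP.≤-refl {m}) | extend-new w =
      λ same → new (i , i<j , SameEdge-sym same)

    first′ : γ (q 0) (q 1) ≡ b
    first′ rewrite extend-old w {0} z≤n | extend-old w {1} (s≤s z≤n) = first-colour

    magnitude′ : ∀ i → i < suc m → ∣ γ (q i) (q (suc i)) ∣ ≡ altMag a b i
    magnitude′ i lt with ℕP.m<1+n⇒m<n∨m≡n lt
    ... | inj₁ i<m rewrite extend-old w (ℕP.<⇒≤ i<m) | extend-old w i<m = magnitude i i<m
    ... | inj₂ refl rewrite extend-old w (ℕP.≤-refl {m}) | extend-new w =
      trans (cong ∣_∣ w-colour) y-magnitude

    condition′ : ∀ j → suc j < suc m →
      SameSet2 (γ (q (suc j)) (q j)) (γ (q (suc j)) (q (suc (suc j))))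
               (negPow (tcount G q (suc j)) *ℤ a) (negPow (tcount G q (suc j)) *ℤ b)
    condition′ j lt with ℕP.m<1+n⇒m<n∨m≡n lt
    ... | inj₁ sj<m rewrite tcount-extend w (ℕP.<⇒≤ sj<m) | extend-old w (ℕP.<⇒≤ sj<m)
                          | extend-old w (ℕP.<⇒≤ (ℕP.<⇒≤ sj<m)) | extend-old w sj<m = condition j sj<m
    ... | inj₂ refl rewrite tcount-extend w (ℕP.≤-refl {m}) | extend-old w (ℕP.≤-refl {m})
                          | extend-old w (ℕP.n≤1+n k) | extend-new w =
      subst (λ c → SameSet2 x c sa sb) (sym w-colour) (samePair⇒sameSet2 last-pair)

  off-chain-avoids-y : ∀ {v w} → v ≡ p m → Adj G v w → ¬ EdgeOf m p v w → γ v w ≢ y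
  off-chain-avoids-y {w = w} refl end-w new w-colour = ℕP.<-irrefl (sym longer≡m) (ℕP.n<1+n m)
    where
    longer≡m : suc m ≡ m
    longer≡m = maximal (suc m) (extend w) (ℕP.n≤1+n m) (λ _ → extend-old w)
                       (extension-is-chain w end-w new w-colour)

  inner-avoids-y : ∀ j → suc j < m → p (suc j) ≡ p m →
                   ¬ OneOf (γ (p (suc j)) (p j)) (γ (p (suc j)) (p (suc (suc j)))) y
  inner-avoids-y j lt at-end y∈inner = [ x≢back , x≢fwd ] (samePair-oneOf⁻ (inner-pair j lt) x∈inner)
    where
    x∈inner : OneOf (ε (suc j) · a) (ε (suc j) · b) x
    x∈inner = signed-overlap (ε (suc j)) (ε m) (samePair-oneOf (inner-pair j lt) y∈inner)
      (samePair-oneOf last-pair-signed (inj₂ refl)) (samePair-oneOf last-pair-signed (inj₁ refl))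
    x≢back : x ≢ γ (p (suc j)) (p j)
    x≢back x≡back = inner-back-not-last j lt
      (at-end , end-colour-unique at-end (adj-sym G (adjacent j (ℕP.<⇒≤ lt))) (sym x≡back))
    x≢fwd : x ≢ γ (p (suc j)) (p (suc (suc j)))
    x≢fwd x≡fwd = inner-fwd-not-last j lt
      (at-end , end-colour-unique at-end (adjacent (suc j) lt) (sym x≡fwd))

  end-colours-avoid : ∀ {v w} → v ≡ p m → Adj G v w → ¬ FirstIncidence v w → ¬ LastIncidence v w →
                      ¬ OneOf x y (γ v w)
  end-colours-avoid at-end vw _ ¬last (inj₁ c≡x) = ¬last (at-end , end-colour-unique at-end vw c≡x)
  end-colours-avoid {v} {w} at-end vw ¬first ¬last (inj₂ c≡y) with classify v w
  ... | off-chain ∉      = off-chain-avoids-y at-end vw ∉ c≡y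
  ... | first            = ¬first (refl , refl)
  ... | last             = ¬last (refl , refl)
  ... | inner-back j lt  = inner-avoids-y j lt at-end (inj₁ (sym c≡y))
  ... | inner-fwd j lt   = inner-avoids-y j lt at-end (inj₂ (sym c≡y))

  away-from-ends : ∀ v → v ≢ p 0 → v ≢ p m → ∀ c → Present G γ′ v c ⇔ Present G γ v c
  away-from-ends v v≢start v≢end =
    swap-present v id id (λ _ _ _ _ → refl) (⊥-elim ∘ v≢start) (⊥-elim ∘ v≢end)

  at-start : p 0 ≢ p m → ∀ c → Present G γ′ (p 0) c ⇔ Present G γ (p 0) (transp a b c)
  at-start open-chain = swap-present (p 0) (transp a b) (transp-injective a b)
    (λ _ vw ¬first _ → transp-fixes a b (start-colours-avoid refl vw ¬first))
    (λ _ → transp-left a b) (⊥-elim ∘ open-chain)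

  at-end : p 0 ≢ p m → ∀ c → Present G γ′ (p m) c ⇔ Present G γ (p m) (transp sa sb c)
  at-end open-chain = swap-present (p m) (transp sa sb) (transp-injective sa sb)
    (λ _ vw ¬first ¬last → transp-fixes sa sb
       (end-colours-avoid refl vw ¬first ¬last ∘ samePair-oneOf⁻ last-pair))
    (⊥-elim ∘ open-chain ∘ sym) (λ _ → transp-samePair last-pair)

  at-closed : p 0 ≡ p m → ∀ c → Present G γ′ (p 0) c ⇔ Present G γ (p 0) (transp a b (transp sa sb c))
  at-closed closed = swap-present (p 0) τ τ-injective fixes (λ _ → τ-a) (λ _ → τ-y)
    where
    τ : ℤ → ℤ
    τ c = transp a b (transp sa sb c)

    τ-injective : Injective _≡_ _≡_ τ
    τ-injective e = transp-injective sa sb (transp-injective a b e)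

    x∉ab : ¬ OneOf a b x
    x∉ab = start-colours-avoid (sym closed) end-adj last-not-first

    ends-disjoint : ∀ {z} → OneOf a b z → ¬ OneOf sa sb z
    ends-disjoint z∈ab z∈s = x∉ab (signed-overlap pos (ε m) z∈ab
      (samePair-oneOf last-pair-signed (samePair-oneOf⁻ last-pair z∈s))
      (samePair-oneOf last-pair-signed (inj₁ refl)))

    fixes : FixesOffEnds (p 0) τ
    fixes _ vw ¬first ¬last = trans
      (cong (transp a b) (transp-fixes sa sb (end-colours-avoid closed vw ¬first ¬last ∘ samePair-oneOf⁻ last-pair)))
      (transp-fixes a b (start-colours-avoid refl vw ¬first))

    τ-a : τ a ≡ b
    τ-a = trans (cong (transp a b) (transp-fixes sa sb (ends-disjoint (inj₁ refl)))) (transp-left a b)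

    τ-y : τ y ≡ x
    τ-y = trans (cong (transp a b) (transp-samePair last-pair)) (transp-fixes a b x∉ab)

swap-along-empty-trail : ∀ {N} (G : SignedGraph N) {γ γ′ : Coloring N} {a b} (p : ℕ → Fin N) →
  IsSwap a b 0 p γ γ′ → ∀ v c → Present G γ′ v c ⇔ Present G γ v c
swap-along-empty-trail G {γ} {γ′} p swap v =
  present-relabel G γ γ′ v id id (λ w vw → w , vw , untouched w , untouched w)
  where
  untouched : ∀ w → γ′ v w ≡ γ v w
  untouched w = proj₂ (swap v w) λ { (_ , () , _) }

mainTheorem13 :
    ∀ {N : ℕ} (G : SignedGraph N) (n : ℕ) (γ γ′ : Coloring N)
      (a b : ℤ) (v₀ : Fin N) (m : ℕ) (p : ℕ → Fin N) →
    1 ≤ n →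
    IsEdgeColoring G n γ → IsProper G γ →
    InM n a → InM n b → a ≢ 0ℤ → b ≢ 0ℤ →
    Absent G γ v₀ a → Present G γ v₀ b →
    IsChain G γ a b v₀ m p →
    IsSwap a b m p γ γ′ →
    let s = negPow (tcount G p m) in
    (∀ v → v ≢ v₀ → v ≢ p m → ∀ c →
       (Present G γ′ v c ⇔ Present G γ v c) ×
       (Absent G γ′ v c ⇔ Absent G γ v c)) ×
    (v₀ ≢ p m → ∀ c → Present G γ′ v₀ c ⇔ Present G γ v₀ (transp a b c)) ×
    (v₀ ≢ p m → ∀ c →
       Present G γ′ (p m) c ⇔ Present G γ (p m) (transp (s *ℤ a) (s *ℤ b) c)) ×
    (v₀ ≡ p m → ∀ c →
       Present G γ′ v₀ c ⇔ Present G γ v₀ (transp a b (transp (s *ℤ a) (s *ℤ b) c)))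
mainTheorem13 G n γ γ′ a b .(p 0) zero p _ _ _ _ _ _ _ _ _ ((refl , _) , _) swap =
  (λ v _ _ c → unchanged v c , ¬-cong-⇔ (unchanged v c)) ,
  (λ open-chain → ⊥-elim (open-chain refl)) , (λ open-chain → ⊥-elim (open-chain refl)) ,
  λ _ c → subst (λ d → Present G γ′ (p 0) c ⇔ Present G γ (p 0) d) (sym (transp-twice c)) (unchanged (p 0) c)
  where
  unchanged : ∀ v c → Present G γ′ v c ⇔ Present G γ v c
  unchanged = swap-along-empty-trail G p swap
  transp-twice : ∀ c → transp a b (transp (1ℤ *ℤ a) (1ℤ *ℤ b) c) ≡ c
  transp-twice c rewrite ℤP.*-identityˡ a | ℤP.*-identityˡ b = transp-involutive a b c
mainTheorem13 G n γ γ′ a b .(p 0) (suc k) p _ colouring proper _ _ a≢0 b≢0 absent present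
              ((refl , trail , starts-with-b , magnitude , condition) , maximal) swap =
  (λ v v≢start v≢end c → away-from-ends v v≢start v≢end c , ¬-cong-⇔ (away-from-ends v v≢start v≢end c)) ,
  at-start , at-end , at-closed
  where
  open Chain G γ γ′ a b k p (λ v w vw → proj₂ (colouring v w vw)) proper a≢0 b≢0 absent present
             trail starts-with-b magnitude condition maximal swap
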